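{- Let $G=U\times V$ be a finite CI-group with $\gcd(|U|,|V|)=1$, where $U$ is abelian with all Sylow subgroups elementary abelian, and $V$ is isomorphic to one of $Q_8$, $\mathbb{Z}_2^2\rtimes\mathbb{Z}_3$, $\mathbb{Z}_2^2\rtimes\mathbb{Z}_9$, $Q_8\rtimes\mathbb{Z}_3$, $Q_8\rtimes\mathbb{Z}_9$, $\mathbb{Z}_3^2\rtimes Q_8$. Then $G$ does not have the $k$-if property for any integer $k\geq2$.
   Context: $Q_8$ is the quaternion group of order 8; the semidirect products are the nonabelian ones (the cyclic factor acting via an automorphism of order 3, and $Q_8$ acting faithfully on $\mathbb{Z}_3^2$). For a finite group $G$ let $G^*=G\setminus\{1\}$. For an inverse-closed $S\subseteq G^*$, $\mathrm{Cay}(G,S)$ has vertex set $G$ and edges $\{h,g\}$ with $gh^{ -1}\in S$. $G$ is a CI-group if for all inverse-closed $S,T\subseteq G^*$, $\mathrm{Cay}(G,S)\cong\mathrm{Cay}(G,T)$ implies $T=S^{\alpha}$ for some $\alpha\in\mathrm{Aut}(G)$. A partition of a set is a collection of non-empty pairwise disjoint subsets whose union is the set. $\mathrm{Cay}(G,S)$ is a $k$-if Cayley graph if there is a partition $\{S_0=S,\dots,S_{k-1}\}$ of $G^*$ into inverse-closed subsets with $\mathrm{Cay}(G,S_i)\cong\mathrm{Cay}(G,S)$ for all $i$; $G$ has the $k$-if property if some $\mathrm{Cay}(G,S)$ is a $k$-if Cayley graph. -}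

module Defs where

open import Level using (0ℓ)
open import Data.Nat using (ℕ; zero; suc; _+_; _*_; _^_; NonZero)
open import Data.Nat.Divisibility using (_∣_)
open import Data.Nat.ListAction using (sum)
open import Data.Nat.DivMod using (_%_; m%n<n)
open import Data.Nat.Primality using (Prime)
open import Data.Bool using (Bool; true; false; _xor_; not; _∧_; if_then_else_)
open import Data.Fin using (Fin; toℕ; fromℕ<)
import Data.Fin as Fin
open import Data.List using (List; map; allFin)
open import Data.Product using (Σ; ∃; _×_; _,_)
open import Data.Sum using (_⊎_)
open import Relation.Binary.PropositionalEquality using (_≡_)
open import Relation.Nullary using (¬_; Dec; yes; no)
open import Relation.Nullary.Decidable using (⌊_⌋)
open import Function.Bundles using (_⤖_; Bijection)
open import Algebra.Structures using (IsGroup)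

record FinGroup : Set₁ where
  infixl 7 _∙_
  field
    Carrier : Set
    _∙_     : Carrier → Carrier → Carrier
    ε       : Carrier
    _⁻¹     : Carrier → Carrier
    isGroup : IsGroup {A = Carrier} _≡_ _∙_ ε _⁻¹
    order   : ℕ
    enum    : Fin order ⤖ Carrier

open FinGroup public

MulIso : (A : Set) → (A → A → A) → (B : Set) → (B → B → B) → Set
MulIso A m B n =
  Σ (A ⤖ B) λ f → ∀ x y → Bijection.to f (m x y) ≡ n (Bijection.to f x) (Bijection.to f y)

IsDirectProduct : FinGroup → FinGroup → FinGroup → Set
IsDirectProduct G U V =
  MulIso (Carrier U × Carrier V)
         (λ { (u , v) (u' , v') → (_∙_ U u u' , _∙_ V v v') })
         (Carrier G) (_∙_ G)

Abelian : FinGroup → Set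
Abelian G = ∀ x y → _∙_ G x y ≡ _∙_ G y x

pow : (G : FinGroup) → Carrier G → ℕ → Carrier G
pow G x zero    = ε G
pow G x (suc n) = _∙_ G x (pow G x n)

Subset : FinGroup → Set
Subset G = Carrier G → Bool

_∈_ : {G : FinGroup} → Carrier G → Subset G → Set
x ∈ S = S x ≡ true

card : (G : FinGroup) → Subset G → ℕ
card G H = sum (map (λ i → if H (Bijection.to (enum G) i) then 1 else 0) (allFin (order G)))

IsSubgroup : (G : FinGroup) → Subset G → Set
IsSubgroup G H =
  (_∈_ {G} (ε G) H)
  × (∀ x y → _∈_ {G} x H → _∈_ {G} y H → _∈_ {G} (_∙_ G x y) H)
  × (∀ x → _∈_ {G} x H → _∈_ {G} (_⁻¹ G x) H)

IsSylow : (G : FinGroup) → ℕ → Subset G → Set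
IsSylow G p H =
  IsSubgroup G H
  × Σ ℕ λ a → (card G H ≡ p ^ a) × (p ^ a ∣ order G) × ¬ (p ^ suc a ∣ order G)

IsElemAbelian : (G : FinGroup) → ℕ → Subset G → Set
IsElemAbelian G p H =
  (∀ x y → _∈_ {G} x H → _∈_ {G} y H → _∙_ G x y ≡ _∙_ G y x)
  × (∀ x → _∈_ {G} x H → pow G x p ≡ ε G)

AllSylowElemAbelian : FinGroup → Set
AllSylowElemAbelian G =
  ∀ p → Prime p → ∀ H → IsSylow G p H → IsElemAbelian G p H

InvClosed : (G : FinGroup) → Subset G → Set
InvClosed G S = (S (ε G) ≡ false) × (∀ g → S (_⁻¹ G g) ≡ S g)

CayIso : (G : FinGroup) → Subset G → Subset G → Set
CayIso G S T =
  Σ (Carrier G ⤖ Carrier G) λ φ →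
    ∀ g h → S (_∙_ G g (_⁻¹ G h))
          ≡ T (_∙_ G (Bijection.to φ g) (_⁻¹ G (Bijection.to φ h)))

Aut : FinGroup → Set
Aut G = MulIso (Carrier G) (_∙_ G) (Carrier G) (_∙_ G)

IsCI : FinGroup → Set
IsCI G =
  ∀ (S T : Subset G) → InvClosed G S → InvClosed G T → CayIso G S T →
    Σ (Aut G) λ α → ∀ g → T (Bijection.to (Data.Product.proj₁ α) g) ≡ S g

IsInvClosedPartition : (G : FinGroup) (k : ℕ) → (Fin k → Subset G) → Set
IsInvClosedPartition G k P =
  (∀ i → InvClosed G (P i))
  × (∀ i → ∃ λ g → _∈_ {G} g (P i))
  × (∀ i j g → _∈_ {G} g (P i) → _∈_ {G} g (P j) → i ≡ j)
  × (∀ g → ¬ (g ≡ ε G) → ∃ λ i → _∈_ {G} g (P i))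

IsKIf : (G : FinGroup) → ℕ → Subset G → Set
IsKIf G k S =
  Σ (Fin k → Subset G) λ P →
    IsInvClosedPartition G k P
    × (∃ λ i₀ → ∀ g → P i₀ g ≡ S g)
    × (∀ i → CayIso G (P i) S)

HasKIf : FinGroup → ℕ → Set
HasKIf G k = ∃ λ S → IsKIf G k S

modN : (n : ℕ) → .{{_ : NonZero n}} → ℕ → Fin n
modN n x = fromℕ< (m%n<n x n)

addZ : (n : ℕ) → .{{_ : NonZero n}} → Fin n → Fin n → Fin n
addZ n a b = modN n (toℕ a + toℕ b)

iter : {A : Set} → ℕ → (A → A) → A → A
iter zero    f x = x
iter (suc n) f x = f (iter n f x)

semidirect : {N C : Set} → (N → N → N) → (C → C → C) → (C → N → N) →
             N × C → N × C → N × C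
semidirect mN mC φ (n , c) (m , d) = (mN n (φ c m) , mC c d)

-- Q8 = {±1, ±i, ±j, ±k}; Bool = "is negative"
data Axis : Set where
  e₁ eᵢ eⱼ eₖ : Axis

axMul : Axis → Axis → Bool × Axis
axMul e₁ b  = (false , b)
axMul a  e₁ = (false , a)
axMul eᵢ eᵢ = (true , e₁)
axMul eⱼ eⱼ = (true , e₁)
axMul eₖ eₖ = (true , e₁)
axMul eᵢ eⱼ = (false , eₖ)
axMul eⱼ eᵢ = (true , eₖ)
axMul eⱼ eₖ = (false , eᵢ)
axMul eₖ eⱼ = (true , eᵢ)
axMul eₖ eᵢ = (false , eⱼ)
axMul eᵢ eₖ = (true , eⱼ)

Q8 : Set
Q8 = Bool × Axis

q8mul : Q8 → Q8 → Q8
q8mul (s , a) (t , b) with axMul a b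
... | (u , c) = ((s xor t) xor u , c)

rotQ8 : Q8 → Q8
rotQ8 (s , e₁) = (s , e₁)
rotQ8 (s , eᵢ) = (s , eⱼ)
rotQ8 (s , eⱼ) = (s , eₖ)
rotQ8 (s , eₖ) = (s , eᵢ)

Z2² : Set
Z2² = Bool × Bool

z2²add : Z2² → Z2² → Z2²
z2²add (a , b) (c , d) = (a xor c , b xor d)

rotZ2² : Z2² → Z2²
rotZ2² (a , b) = (b , a xor b)

-- Z3^2 and the faithful action of Q8 on it (Q8 ≤ SL(2,3))
Z3² : Set
Z3² = Fin 3 × Fin 3

z3²add : Z3² → Z3² → Z3²
z3²add (a , b) (c , d) = (addZ 3 a c , addZ 3 b d)

-- matrix (m11, m12, m21, m22) over ℕ (entries taken mod 3)
Mat : Set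
Mat = ℕ × ℕ × ℕ × ℕ

axMat : Axis → Mat
axMat e₁ = (1 , 0 , 0 , 1)
axMat eᵢ = (0 , 2 , 1 , 0)
axMat eⱼ = (1 , 1 , 1 , 2)
axMat eₖ = (2 , 1 , 1 , 1)

actMat : Mat → Z3² → Z3²
actMat (p , q , r , s) (a , b) =
  (modN 3 (p * toℕ a + q * toℕ b) , modN 3 (r * toℕ a + s * toℕ b))

q8ActZ3² : Q8 → Z3² → Z3²
q8ActZ3² (false , a) v = actMat (axMat a) v
q8ActZ3² (true  , a) v = actMat (axMat a) (actMat (2 , 0 , 0 , 2) v)

Z2²⋊Z3-mul : Z2² × Fin 3 → Z2² × Fin 3 → Z2² × Fin 3
Z2²⋊Z3-mul = semidirect z2²add (addZ 3) (λ c → iter (toℕ c) rotZ2²)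

Z2²⋊Z9-mul : Z2² × Fin 9 → Z2² × Fin 9 → Z2² × Fin 9
Z2²⋊Z9-mul = semidirect z2²add (addZ 9) (λ c → iter (toℕ c) rotZ2²)

Q8⋊Z3-mul : Q8 × Fin 3 → Q8 × Fin 3 → Q8 × Fin 3
Q8⋊Z3-mul = semidirect q8mul (addZ 3) (λ c → iter (toℕ c) rotQ8)

Q8⋊Z9-mul : Q8 × Fin 9 → Q8 × Fin 9 → Q8 × Fin 9
Q8⋊Z9-mul = semidirect q8mul (addZ 9) (λ c → iter (toℕ c) rotQ8)

Z3²⋊Q8-mul : Z3² × Q8 → Z3² × Q8 → Z3² × Q8
Z3²⋊Q8-mul = semidirect z3²add q8mul q8ActZ3²

IsoTo : FinGroup → (A : Set) → (A → A → A) → Set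
IsoTo V A m = MulIso A m (Carrier V) (_∙_ V)

OneOfSix : FinGroup → Set
OneOfSix V =
  IsoTo V Q8 q8mul
  ⊎ IsoTo V (Z2² × Fin 3) Z2²⋊Z3-mul
  ⊎ IsoTo V (Z2² × Fin 9) Z2²⋊Z9-mul
  ⊎ IsoTo V (Q8 × Fin 3) Q8⋊Z3-mul
  ⊎ IsoTo V (Q8 × Fin 9) Q8⋊Z9-mul
  ⊎ IsoTo V (Z3² × Q8) Z3²⋊Q8-mul

-- Suppose Cay(G,S) is k-if, with parts P₀, …, P_{k-1}. Each Cay(G,Pᵢ) is isomorphic to Cay(G,S), so
-- the CI property gives automorphisms αᵢ with αᵢ(Pᵢ) = S. Hence every automorphism-invariant set
-- X ⊆ G ∖ {1} meets all parts in equally many elements, and k divides |X|.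
-- Take X = {g ≠ 1 : g^d = 1} with d dividing |V|. Since U is abelian, u^|U| = 1 for all u ∈ U
-- (the product of all elements equals the product of their u-multiples), and d is prime to |U|,
-- so X lies in the factor V and |X| counts the nontrivial v ∈ V with v^d = 1.
-- In the multiplication tables of the six groups these counts for d = 2 and d = 3 are coprime
-- (Q₈, Q₈⋊ℤ₃ and Q₈⋊ℤ₉ have one involution; ℤ₂²⋊ℤ₃, ℤ₂²⋊ℤ₉ and ℤ₃²⋊Q₈ have 3 and 8, 3 and 2,
-- 9 and 8 nontrivial elements of order dividing 2 and 3), which forces k = 1.
module Submission where

open import Level using (0ℓ)
open import Algebra.Bundles using (Group; CommutativeMonoid)
import Algebra.Properties.CommutativeMonoid.Sum as Sum
import Algebra.Properties.Group as GroupProperties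
open import Data.Bool using (Bool; true; false; if_then_else_)
import Data.Bool as Bool
open import Data.Bool.Properties using (¬-not)
open import Data.Fin using (Fin; punchIn)
import Data.Fin as Fin
open import Data.Fin.Patterns using (0F; 1F; 2F; 3F)
open import Data.Fin.Permutation using (Permutation; _⟨$⟩ʳ_)
open import Data.Fin.Properties using (punchInᵢ≢i)
open import Data.List using (List; []; _∷_; map; length; allFin; cartesianProduct; filter; lookup)
open import Data.List.Properties using (length-map; length-tabulate)
open import Data.List.Membership.Propositional using (_∈_)
open import Data.List.Membership.Propositional.Properties
  using (∈-allFin; ∈-cartesianProduct⁺; ∈-map⁺; ∈-map⁻; ∈-filter⁺; ∈-filter⁻)
open import Data.List.Membership.Propositional.Properties.WithK using (unique∧set⇒bag)
open import Data.List.Relation.Binary.BagAndSetEquality using (_∼[_]_; set; ∼bag⇒↭)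
open import Data.List.Relation.Binary.Permutation.Propositional.Properties using (↭-length)
open import Data.List.Relation.Unary.All using ([]; _∷_)
open import Data.List.Relation.Unary.AllPairs using ([]; _∷_)
open import Data.List.Relation.Unary.Any using (here; there)
open import Data.List.Relation.Unary.Unique.Propositional using (Unique)
import Data.List.Relation.Unary.Unique.Propositional.Properties as Unique
open import Data.Nat using (ℕ; zero; suc; _+_; _*_; _≤_)
open import Data.Nat.Coprimality using (Coprime; coprime-Bézout; gcd≡1⇒coprime)
open import Data.Nat.Divisibility using (_∣_; _∣?_; ∣-trans; m∣m*n; ∣1⇒≡1)
open import Data.Nat.GCD using (gcd; gcd-greatest; module Bézout)
open import Data.Nat.Properties using (*-zeroʳ; <⇒≢; +-0-commutativeMonoid)
open Sum +-0-commutativeMonoid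
  using (sum-syntax; sum-remove; sum-cong-≗; sum-replicate-zero; ∑-distrib-+)
open import Data.Product using (∃; _×_; _,_; proj₁; proj₂)
open import Data.Product.Properties using (≡-dec)
open import Data.Sum using (inj₁; inj₂)
open import Function using (_∘_; id; case_of_)
open import Function.Bundles
  using (_⤖_; _⇔_; _↔_; mk⇔; mk↣; mk↔ₛ′; Bijection; Equivalence; Inverse)
open import Function.Construct.Composition using (_↔-∘_; _⇔-∘_)
open import Function.Construct.Symmetry using (↔-sym; ⇔-sym)
open import Function.Properties.Bijection using (⤖⇒↔)
open import Relation.Binary.Definitions using (DecidableEquality)
open import Relation.Binary.PropositionalEquality
  using (_≡_; refl; sym; trans; cong; cong₂; subst; module ≡-Reasoning)
open import Relation.Nullary using (¬_; ¬?; _×-dec_)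
open import Relation.Nullary.Decidable using (True; toWitness; via-injection)
open import Relation.Unary using (Decidable)

open import Defs hiding (_∈_)

module _ {A : Set} {xs ys : List A} (xs! : Unique xs) (ys! : Unique ys) where

  length-unique-set : xs ∼[ set ] ys → length xs ≡ length ys
  length-unique-set xs∼ys = ↭-length (∼bag⇒↭ (unique∧set⇒bag xs! ys! xs∼ys))

  length-unique-complete : (∀ x → x ∈ xs) → (∀ x → x ∈ ys) → length xs ≡ length ys
  length-unique-complete xs-all ys-all = length-unique-set (mk⇔ (λ _ → ys-all _) (λ _ → xs-all _))

module _ {A B : Set} (f : A ⤖ B) {xs : List A} where
  open Bijection f

  map-bijection-unique : Unique xs → Unique (map to xs)
  map-bijection-unique = Unique.map⁺ injective

  map-bijection-complete : (∀ x → x ∈ xs) → ∀ y → y ∈ map to xs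
  map-bijection-complete xs-all y with x , refl ← strictlySurjective y = ∈-map⁺ to (xs-all x)

record Finite (A : Set) : Set where
  field
    _≟_      : DecidableEquality A
    elements : List A
    unique   : Unique elements
    complete : ∀ x → x ∈ elements

finite-Bool : Finite Bool
finite-Bool = record
  { _≟_      = Bool._≟_
  ; elements = false ∷ true ∷ []
  ; unique   = ((λ ()) ∷ []) ∷ [] ∷ []
  ; complete = λ { false → here refl ; true → there (here refl) }
  }

finite-Fin : ∀ n → Finite (Fin n)
finite-Fin n = record
  { _≟_ = Fin._≟_ ; elements = allFin n ; unique = Unique.allFin⁺ n ; complete = ∈-allFin }

finite-× : ∀ {A B} → Finite A → Finite B → Finite (A × B)
finite-× FA FB = record
  { _≟_      = ≡-dec A._≟_ B._≟_
  ; elements = cartesianProduct A.elements B.elements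
  ; unique   = Unique.cartesianProduct⁺ A.unique B.unique
  ; complete = λ (x , y) → ∈-cartesianProduct⁺ (A.complete x) (B.complete y)
  }
  where
  module A = Finite FA
  module B = Finite FB

axes : List Axis
axes = e₁ ∷ eᵢ ∷ eⱼ ∷ eₖ ∷ []

axis-index : Axis → Fin 4
axis-index e₁ = 0F
axis-index eᵢ = 1F
axis-index eⱼ = 2F
axis-index eₖ = 3F

axis-index-injective : ∀ {x y} → axis-index x ≡ axis-index y → x ≡ y
axis-index-injective {x} {y} eq =
  trans (sym (lookup-index x)) (trans (cong (lookup axes) eq) (lookup-index y))
  where
  lookup-index : ∀ x → lookup axes (axis-index x) ≡ x
  lookup-index e₁ = refl
  lookup-index eᵢ = refl
  lookup-index eⱼ = refl
  lookup-index eₖ = refl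

finite-Axis : Finite Axis
finite-Axis = record
  { _≟_      = via-injection (mk↣ axis-index-injective) Fin._≟_
  ; elements = axes
  ; unique   = ((λ ()) ∷ (λ ()) ∷ (λ ()) ∷ []) ∷ ((λ ()) ∷ (λ ()) ∷ []) ∷ ((λ ()) ∷ []) ∷ [] ∷ []
  ; complete = λ { e₁ → here refl ; eᵢ → there (here refl)
                 ; eⱼ → there (there (here refl)) ; eₖ → there (there (there (here refl))) }
  }

finite-Q8 : Finite Q8
finite-Q8 = finite-× finite-Bool finite-Axis

finite-Z2² : Finite Z2²
finite-Z2² = finite-× finite-Bool finite-Bool

finite-Z3² : Finite Z3²
finite-Z3² = finite-× (finite-Fin 3) (finite-Fin 3)

count : {A : Set} → (A → Bool) → List A → ℕ
count p xs = length (filter (λ x → p x Bool.≟ true) xs)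

count-∷ : {A : Set} (p : A → Bool) (x : A) (xs : List A) →
          count p (x ∷ xs) ≡ (if p x then 1 else 0) + count p xs
count-∷ p x xs with p x
... | true  = refl
... | false = refl

count-transport : ∀ {A : Set} (f : A ⤖ A) {xs : List A} → Unique xs →
                  (∀ x → Bijection.to f x ∈ xs ⇔ x ∈ xs) →
                  (p q : A → Bool) → (∀ x → q (Bijection.to f x) ≡ p x) → count p xs ≡ count q xs
count-transport f {xs} xs! invariant p q q∘f≗p = begin
  length (filter P? xs)           ≡⟨ length-map to (filter P? xs) ⟨
  length (map to (filter P? xs))  ≡⟨ length-unique-set (map-bijection-unique f (Unique.filter⁺ P? xs!))
                                                        (Unique.filter⁺ Q? xs!) (mk⇔ ⇒ ⇐) ⟩
  length (filter Q? xs)           ∎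
  where
  open ≡-Reasoning
  open Bijection f using (to; strictlySurjective)
  P? = λ x → p x Bool.≟ true
  Q? = λ x → q x Bool.≟ true
  ⇒ : ∀ {y} → y ∈ map to (filter P? xs) → y ∈ filter Q? xs
  ⇒ y∈ with x , x∈ , refl ← ∈-map⁻ to y∈ with x∈xs , px ← ∈-filter⁻ P? x∈ =
    ∈-filter⁺ Q? (Equivalence.from (invariant x) x∈xs) (trans (q∘f≗p x) px)
  ⇐ : ∀ {y} → y ∈ filter Q? xs → y ∈ map to (filter P? xs)
  ⇐ {y} y∈ with y∈xs , qy ← ∈-filter⁻ Q? y∈ with x , refl ← strictlySurjective y =
    ∈-map⁺ to (∈-filter⁺ P? (Equivalence.to (invariant x) y∈xs) (trans (sym (q∘f≗p x)) qy))

∑-const : ∀ k s → ∑[ i < k ] s ≡ k * s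
∑-const zero    s = refl
∑-const (suc k) s = cong (s +_) (∑-const k s)

∑-indicator-unique : ∀ {k} (b : Fin k → Bool) (i : Fin k) → b i ≡ true →
                     (∀ j → b j ≡ true → j ≡ i) → ∑[ j < k ] (if b j then 1 else 0) ≡ 1
∑-indicator-unique {suc k} b i bi only-i = begin
  ∑[ j < suc k ] indicator j                   ≡⟨ sum-remove {i = i} indicator ⟩
  indicator i + ∑[ j < k ] indicator (punchIn i j)
    ≡⟨ cong₂ _+_ (cong toℕ bi) (sum-cong-≗ (cong toℕ ∘ b-punchIn)) ⟩
  1 + ∑[ j < k ] 0                             ≡⟨ cong suc (sum-replicate-zero k) ⟩
  1                                            ∎
  where
  open ≡-Reasoning
  toℕ : Bool → ℕ
  toℕ c = if c then 1 else 0
  indicator : Fin (suc k) → ℕ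
  indicator = toℕ ∘ b
  b-punchIn : ∀ j → b (punchIn i j) ≡ false
  b-punchIn j = ¬-not (punchInᵢ≢i i j ∘ only-i (punchIn i j))

partition-count : ∀ {A : Set} {k} (P : Fin k → A → Bool) (xs : List A) →
                  (∀ x → x ∈ xs → ∃ λ i → P i x ≡ true) →
                  (∀ i j x → P i x ≡ true → P j x ≡ true → i ≡ j) →
                  ∑[ i < k ] count (P i) xs ≡ length xs
partition-count {k = k} P []       covers disjoint = trans (∑-const k 0) (*-zeroʳ k)
partition-count {k = k} P (x ∷ xs) covers disjoint = begin
  ∑[ i < k ] count (P i) (x ∷ xs)                          ≡⟨ sum-cong-≗ (λ i → count-∷ (P i) x xs) ⟩
  ∑[ i < k ] ((if P i x then 1 else 0) + count (P i) xs)
    ≡⟨ ∑-distrib-+ (λ i → if P i x then 1 else 0) (λ i → count (P i) xs) ⟩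
  ∑[ i < k ] (if P i x then 1 else 0) + ∑[ i < k ] count (P i) xs
    ≡⟨ cong₂ _+_ (∑-indicator-unique (λ i → P i x) i Pix (λ j Pjx → disjoint j i x Pjx Pix))
                 (partition-count P xs (λ y → covers y ∘ there) disjoint) ⟩
  suc (length xs)                                          ∎
  where
  open ≡-Reasoning
  i   = proj₁ (covers x (here refl))
  Pix = proj₂ (covers x (here refl))

toGroup : FinGroup → Group 0ℓ 0ℓ
toGroup G = record
  { Carrier = Carrier G ; _≈_ = _≡_ ; _∙_ = _∙_ G ; ε = ε G ; _⁻¹ = _⁻¹ G ; isGroup = isGroup G }

module _ (G : FinGroup) where
  open FinGroup G using () renaming (_∙_ to _·_; ε to e)
  open Group (toGroup G) using (assoc; identityˡ; identityʳ; _\\_)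
  open GroupProperties (toGroup G) using (identityˡ-unique; \\-leftDividesˡ; \\-leftDividesʳ)

  module _ {A : Set} {_*_ : A → A → A} {a₀ : A} (f : A → Carrier G)
           (f-hom : ∀ a b → f (a * b) ≡ f a · f b) where

    hom-idempotent≡ε : a₀ * a₀ ≡ a₀ → f a₀ ≡ e
    hom-idempotent≡ε a₀a₀≡a₀ =
      identityˡ-unique (f a₀) (f a₀) (trans (sym (f-hom a₀ a₀)) (cong f a₀a₀≡a₀))

    hom-pow : f a₀ ≡ e → ∀ a n → f (iter n (a *_) a₀) ≡ pow G (f a) n
    hom-pow fa₀≡e a zero    = fa₀≡e
    hom-pow fa₀≡e a (suc n) = trans (f-hom a _) (cong (f a ·_) (hom-pow fa₀≡e a n))

  pow-+ : ∀ x m n → pow G x (m + n) ≡ pow G x m · pow G x n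
  pow-+ x zero    n = sym (identityˡ _)
  pow-+ x (suc m) n = trans (cong (x ·_) (pow-+ x m n)) (sym (assoc _ _ _))

  pow-multiple : ∀ x d → pow G x d ≡ e → ∀ q → pow G x (q * d) ≡ e
  pow-multiple x d xᵈ≡e zero    = refl
  pow-multiple x d xᵈ≡e (suc q) =
    trans (pow-+ x d (q * d)) (trans (cong₂ _·_ xᵈ≡e (pow-multiple x d xᵈ≡e q)) (identityˡ e))

  bézout-exponents⇒ε : ∀ {x m n} s t → pow G x m ≡ e → pow G x n ≡ e → 1 + s * m ≡ t * n → x ≡ e
  bézout-exponents⇒ε {x} {m} {n} s t xᵐ≡e xⁿ≡e 1+sm≡tn = begin
    x                      ≡⟨ identityʳ x ⟨
    x · e                  ≡⟨ cong (x ·_) (pow-multiple x m xᵐ≡e s) ⟨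
    pow G x (1 + s * m)    ≡⟨ cong (pow G x) 1+sm≡tn ⟩
    pow G x (t * n)        ≡⟨ pow-multiple x n xⁿ≡e t ⟩
    e                      ∎
    where open ≡-Reasoning

  coprime-exponents⇒ε : ∀ {x a b} → Coprime a b → pow G x a ≡ e → pow G x b ≡ e → x ≡ e
  coprime-exponents⇒ε a⊥b xᵃ≡e xᵇ≡e with coprime-Bézout a⊥b
  ... | Bézout.+- s t 1+tb≡sa = bézout-exponents⇒ε t s xᵇ≡e xᵃ≡e 1+tb≡sa
  ... | Bézout.-+ s t 1+sa≡tb = bézout-exponents⇒ε s t xᵃ≡e xᵇ≡e 1+sa≡tb

  left-multiplication : Carrier G → Carrier G ↔ Carrier G
  left-multiplication u = mk↔ₛ′ (u ·_) (u \\_) (\\-leftDividesˡ u) (\\-leftDividesʳ u)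

  module _ (comm : Abelian G) where
    private
      commutativeMonoid : CommutativeMonoid 0ℓ 0ℓ
      commutativeMonoid = record
        { isCommutativeMonoid = record { isMonoid = Group.isMonoid (toGroup G) ; comm = comm } }
      open Sum commutativeMonoid using ()
        renaming (sum to ∏; ∑-permute to ∏-permute; ∑-distrib-+ to ∏-distrib-·; sum-cong-≗ to ∏-cong)

      ∏-const : ∀ n x → ∏ {n} (λ _ → x) ≡ pow G x n
      ∏-const zero    x = refl
      ∏-const (suc n) x = cong (x ·_) (∏-const n x)

    pow-order : ∀ u → pow G u (order G) ≡ e
    pow-order u = identityˡ-unique (pow G u n) (∏ g) (begin
      pow G u n · ∏ g          ≡⟨ cong (_· ∏ g) (∏-const n u) ⟨
      ∏ {n} (λ _ → u) · ∏ g    ≡⟨ ∏-distrib-· (λ _ → u) g ⟨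
      ∏ (λ i → u · g i)        ≡⟨ ∏-cong (λ i → Inverse.strictlyInverseˡ E (u · g i)) ⟨
      ∏ (λ i → g (π ⟨$⟩ʳ i))   ≡⟨ ∏-permute g π ⟨
      ∏ g                      ∎)
      where
      open ≡-Reasoning
      n = order G
      E = ⤖⇒↔ (enum G)
      g = Inverse.to E
      π : Permutation n n
      π = ↔-sym E ↔-∘ (left-multiplication u ↔-∘ E)

Torsion : (G : FinGroup) → ℕ → Carrier G → Set
Torsion G d g = ¬ g ≡ ε G × pow G g d ≡ ε G

module _ {G : FinGroup} (α : Aut G) where
  open Bijection (proj₁ α) using (to; injective)

  aut-ε : to (ε G) ≡ ε G
  aut-ε = hom-idempotent≡ε G to (proj₂ α) (Group.identityˡ (toGroup G) (ε G))

  aut-pow : ∀ g n → to (pow G g n) ≡ pow G (to g) n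
  aut-pow g zero    = aut-ε
  aut-pow g (suc n) = trans (proj₂ α g _) (cong (_∙_ G (to g)) (aut-pow g n))

  torsion-invariant : ∀ d g → Torsion G d (to g) ⇔ Torsion G d g
  torsion-invariant d g = mk⇔
    (λ (αg≢ε , αgᵈ≡ε) → (λ g≡ε → αg≢ε (trans (cong to g≡ε) aut-ε))
                       , injective (trans (aut-pow g d) (trans αgᵈ≡ε (sym aut-ε))))
    (λ (g≢ε , gᵈ≡ε) → (λ αg≡ε → g≢ε (injective (trans αg≡ε (sym aut-ε))))
                     , trans (sym (aut-pow g d)) (trans (cong to gᵈ≡ε) aut-ε))

module Embedding {G U V : FinGroup} (D : IsDirectProduct G U V) where
  open Bijection (proj₁ D) using (to; injective; strictlySurjective)

  embed : Carrier V → Carrier G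
  embed v = to (ε U , v)

  embed-hom : ∀ v w → embed (_∙_ V v w) ≡ _∙_ G (embed v) (embed w)
  embed-hom v w = trans (cong (λ u → to (u , _∙_ V v w)) (sym (Group.identityˡ (toGroup U) (ε U))))
                        (proj₂ D (ε U , v) (ε U , w))

  embed-injective : ∀ {v w} → embed v ≡ embed w → v ≡ w
  embed-injective = cong proj₂ ∘ injective

  torsion⇒embedded : ∀ {d} → Abelian U → Coprime d (order U) →
                     ∀ g → pow G g d ≡ ε G → ∃ λ v → embed v ≡ g
  torsion⇒embedded {d} U-abelian d⊥|U| g gᵈ≡ε with (u , v) , refl ← strictlySurjective g =
    v , cong (λ u → to (u , v)) (sym u≡ε)
    where
    _⊗_ : Carrier U × Carrier V → Carrier U × Carrier V → Carrier U × Carrier V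
    (u , v) ⊗ (u′ , v′) = (_∙_ U u u′ , _∙_ V v v′)
    εε = (ε U , ε V)
    εε-idempotent : εε ⊗ εε ≡ εε
    εε-idempotent = cong₂ _,_ (Group.identityˡ (toGroup U) (ε U)) (Group.identityˡ (toGroup V) (ε V))
    to-εε : to εε ≡ ε G
    to-εε = hom-idempotent≡ε G to (proj₂ D) εε-idempotent
    uvᵈ≡εε : iter d ((u , v) ⊗_) εε ≡ εε
    uvᵈ≡εε = injective (trans (hom-pow G to (proj₂ D) to-εε (u , v) d) (trans gᵈ≡ε (sym to-εε)))
    uᵈ≡ε : pow U u d ≡ ε U
    uᵈ≡ε = trans (sym (hom-pow U {_*_ = _⊗_} proj₁ (λ _ _ → refl) refl (u , v) d)) (cong proj₁ uvᵈ≡εε)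
    u≡ε : u ≡ ε U
    u≡ε = coprime-exponents⇒ε U d⊥|U| uᵈ≡ε (pow-order U U-abelian u)

-- No group axioms are recorded: e · e ≡ e is all it takes for a homomorphism into a group
-- to send e to ε.
record FiniteMagma : Set₁ where
  field
    Elem   : Set
    finite : Finite Elem
    _·_    : Elem → Elem → Elem
    e      : Elem
    e·e≡e  : e · e ≡ e

  open Finite finite public

  size : ℕ
  size = length elements

  torsion? : ∀ d → Decidable (λ a → ¬ a ≡ e × iter d (a ·_) e ≡ e)
  torsion? d a = ¬? (a ≟ e) ×-dec (iter d (a ·_) e ≟ e)

  torsionCount : ℕ → ℕ
  torsionCount d = length (filter (torsion? d) elements)

open FiniteMagma using (Elem; size; torsionCount)

module TorsionList (G : FinGroup) (A : FiniteMagma) (ψ : Elem A → Carrier G)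
                   (ψ-hom : ∀ a b → ψ (FiniteMagma._·_ A a b) ≡ _∙_ G (ψ a) (ψ b))
                   (ψ-injective : ∀ {a b} → ψ a ≡ ψ b → a ≡ b) (d : ℕ)
                   (ψ-onto-torsion : ∀ g → Torsion G d g → ∃ λ a → ψ a ≡ g) where
  open FiniteMagma A hiding (Elem; size; torsionCount)

  torsionList : List (Carrier G)
  torsionList = map ψ (filter (torsion? d) elements)

  length-torsionList : length torsionList ≡ torsionCount A d
  length-torsionList = length-map ψ (filter (torsion? d) elements)

  torsionList-unique : Unique torsionList
  torsionList-unique = Unique.map⁺ ψ-injective (Unique.filter⁺ (torsion? d) unique)

  ∈-torsionList : ∀ g → g ∈ torsionList ⇔ Torsion G d g
  ∈-torsionList g = mk⇔ ⇒ ⇐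
    where
    ψe≡ε : ψ e ≡ ε G
    ψe≡ε = hom-idempotent≡ε G ψ ψ-hom e·e≡e
    ψ-pow : ∀ a → ψ (iter d (a ·_) e) ≡ pow G (ψ a) d
    ψ-pow a = hom-pow G ψ ψ-hom ψe≡ε a d
    ⇒ : g ∈ torsionList → Torsion G d g
    ⇒ g∈ with a , a∈ , refl ← ∈-map⁻ ψ g∈
         with _ , (a≢e , aᵈ≡e) ← ∈-filter⁻ (torsion? d) {xs = elements} a∈ =
      (λ ψa≡ε → a≢e (ψ-injective (trans ψa≡ε (sym ψe≡ε))))
      , trans (sym (ψ-pow a)) (trans (cong ψ aᵈ≡e) ψe≡ε)
    ⇐ : Torsion G d g → g ∈ torsionList
    ⇐ (g≢ε , gᵈ≡ε) with a , refl ← ψ-onto-torsion g (g≢ε , gᵈ≡ε) =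
      ∈-map⁺ ψ (∈-filter⁺ (torsion? d) (complete a)
        ( (λ a≡e → g≢ε (trans (cong ψ a≡e) ψe≡ε))
        , ψ-injective (trans (ψ-pow a) (trans gᵈ≡ε (sym ψe≡ε)))))

kif-count : ∀ {G : FinGroup} {k S} → IsCI G → IsKIf G k S →
            (L : List (Carrier G)) → Unique L → (∀ g → g ∈ L → ¬ g ≡ ε G) →
            (∀ (α : Aut G) g → Bijection.to (proj₁ α) g ∈ L ⇔ g ∈ L) →
            k * count S L ≡ length L
kif-count {G} {k} {S} G-CI (P , (P-inv , _ , P-disjoint , P-covers) , (i₀ , Pi₀≗S) , P≅S)
          L L-unique L-nontrivial L-invariant = begin
  k * count S L               ≡⟨ ∑-const k (count S L) ⟨
  ∑[ i < k ] count S L        ≡⟨ sum-cong-≗ count-part ⟨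
  ∑[ i < k ] count (P i) L    ≡⟨ partition-count P L (λ g → P-covers g ∘ L-nontrivial g) P-disjoint ⟩
  length L                    ∎
  where
  open ≡-Reasoning
  S-inv : InvClosed G S
  S-inv = trans (sym (Pi₀≗S (ε G))) (proj₁ (P-inv i₀))
        , λ g → trans (sym (Pi₀≗S _)) (trans (proj₂ (P-inv i₀) g) (Pi₀≗S g))
  count-part : ∀ i → count (P i) L ≡ count S L
  count-part i with α , S∘α≗Pi ← G-CI (P i) S (P-inv i) S-inv (P≅S i) =
    count-transport (proj₁ α) L-unique (L-invariant α) (P i) S S∘α≗Pi

order≡size : ∀ {V} (A : FiniteMagma) → IsoTo V (Elem A) (FiniteMagma._·_ A) → order V ≡ size A
order≡size {V} A (β , _) = begin
  order V                                                    ≡⟨ length-tabulate id ⟨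
  length (allFin (order V))                                  ≡⟨ length-map enumV (allFin (order V)) ⟨
  length (map enumV (allFin (order V)))
    ≡⟨ length-unique-complete (map-bijection-unique (enum V) (Unique.allFin⁺ _))
                              (map-bijection-unique β A.unique)
                              (map-bijection-complete (enum V) ∈-allFin)
                              (map-bijection-complete β A.complete) ⟩
  length (map (Bijection.to β) A.elements)                   ≡⟨ length-map (Bijection.to β) A.elements ⟩
  size A                                                     ∎
  where
  open ≡-Reasoning
  module A = FiniteMagma A
  enumV = Bijection.to (enum V)

kif⇒∣torsionCount : ∀ (G U V : FinGroup) {k} → IsDirectProduct G U V → IsCI G →
                    Coprime (order U) (order V) → Abelian U →
                    (A : FiniteMagma) → IsoTo V (Elem A) (FiniteMagma._·_ A) →
                    ∀ {d} → d ∣ size A → HasKIf G k → k ∣ torsionCount A d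
kif⇒∣torsionCount G U V {k} D G-CI |U|⊥|V| U-abelian A (β , β-hom) {d} d∣|A| (S , S-kif) =
  subst (k ∣_) (trans kif-count-torsion length-torsionList) (m∣m*n (count S torsionList))
  where
  open Bijection β using (to; injective; strictlySurjective)
  open Embedding {G} {U} {V} D
  ψ : Elem A → Carrier G
  ψ = embed ∘ to
  ψ-hom : ∀ a b → ψ (FiniteMagma._·_ A a b) ≡ _∙_ G (ψ a) (ψ b)
  ψ-hom a b = trans (cong embed (β-hom a b)) (embed-hom _ _)
  d⊥|U| : Coprime d (order U)
  d⊥|U| (i∣d , i∣|U|) = |U|⊥|V| (i∣|U| , ∣-trans i∣d d∣|V|)
    where d∣|V| = subst (d ∣_) (sym (order≡size {V} A (β , β-hom))) d∣|A|
  ψ-onto-torsion : ∀ g → Torsion G d g → ∃ λ a → ψ a ≡ g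
  ψ-onto-torsion g (_ , gᵈ≡ε)
    with v , v↦g ← torsion⇒embedded U-abelian d⊥|U| g gᵈ≡ε
    with a , refl ← strictlySurjective v = a , v↦g
  open TorsionList G A ψ ψ-hom (injective ∘ embed-injective) d ψ-onto-torsion
  kif-count-torsion : k * count S torsionList ≡ length torsionList
  kif-count-torsion = kif-count {G} G-CI S-kif torsionList torsionList-unique
    (λ g g∈L → proj₁ (Equivalence.to (∈-torsionList g) g∈L))
    (λ α g → ⇔-sym (∈-torsionList g)
               ⇔-∘ (torsion-invariant α d g ⇔-∘ ∈-torsionList (Bijection.to (proj₁ α) g)))

no-kif : ∀ (G U V : FinGroup) {k} → IsDirectProduct G U V → IsCI G → gcd (order U) (order V) ≡ 1 →
         Abelian U → (A : FiniteMagma) → IsoTo V (Elem A) (FiniteMagma._·_ A) →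
         (d₁ d₂ : ℕ) → {True (d₁ ∣? size A)} → {True (d₂ ∣? size A)} →
         gcd (torsionCount A d₁) (torsionCount A d₂) ≡ 1 → 2 ≤ k → ¬ HasKIf G k
no-kif G U V {k} D G-CI |U|⊥|V| U-abelian A β d₁ d₂ {d₁∣|A|} {d₂∣|A|} counts-coprime 2≤k G-kif =
  <⇒≢ 2≤k (sym (∣1⇒≡1 (subst (k ∣_) counts-coprime
    (gcd-greatest (k∣count (toWitness d₁∣|A|)) (k∣count (toWitness d₂∣|A|))))))
  where
  k∣count : ∀ {d} → d ∣ size A → k ∣ torsionCount A d
  k∣count d∣|A| = kif⇒∣torsionCount G U V D G-CI (gcd≡1⇒coprime |U|⊥|V|) U-abelian A β d∣|A| G-kif

Q8-table : FiniteMagma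
Q8-table = record
  { Elem = Q8 ; finite = finite-Q8 ; _·_ = q8mul ; e = (false , e₁) ; e·e≡e = refl }

Z2²⋊Z3-table : FiniteMagma
Z2²⋊Z3-table = record
  { Elem = Z2² × Fin 3 ; finite = finite-× finite-Z2² (finite-Fin 3)
  ; _·_ = Z2²⋊Z3-mul ; e = ((false , false) , 0F) ; e·e≡e = refl }

Z2²⋊Z9-table : FiniteMagma
Z2²⋊Z9-table = record
  { Elem = Z2² × Fin 9 ; finite = finite-× finite-Z2² (finite-Fin 9)
  ; _·_ = Z2²⋊Z9-mul ; e = ((false , false) , 0F) ; e·e≡e = refl }

Q8⋊Z3-table : FiniteMagma
Q8⋊Z3-table = record
  { Elem = Q8 × Fin 3 ; finite = finite-× finite-Q8 (finite-Fin 3)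
  ; _·_ = Q8⋊Z3-mul ; e = ((false , e₁) , 0F) ; e·e≡e = refl }

Q8⋊Z9-table : FiniteMagma
Q8⋊Z9-table = record
  { Elem = Q8 × Fin 9 ; finite = finite-× finite-Q8 (finite-Fin 9)
  ; _·_ = Q8⋊Z9-mul ; e = ((false , e₁) , 0F) ; e·e≡e = refl }

Z3²⋊Q8-table : FiniteMagma
Z3²⋊Q8-table = record
  { Elem = Z3² × Q8 ; finite = finite-× finite-Z3² finite-Q8
  ; _·_ = Z3²⋊Q8-mul ; e = ((0F , 0F) , (false , e₁)) ; e·e≡e = refl }

theorem4p5 : (G U V : FinGroup) → IsDirectProduct G U V → IsCI G →
    gcd (order U) (order V) ≡ 1 → Abelian U → AllSylowElemAbelian U →
    OneOfSix V → ∀ (k : ℕ) → 2 ≤ k → ¬ HasKIf G k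
theorem4p5 G U V D G-CI |U|⊥|V| U-abelian _ V≅ k = case V≅ of λ where
    (inj₁ β)                             → ruled-out Q8-table     β 2 2 refl
    (inj₂ (inj₁ β))                      → ruled-out Z2²⋊Z3-table β 2 3 refl
    (inj₂ (inj₂ (inj₁ β)))               → ruled-out Z2²⋊Z9-table β 2 3 refl
    (inj₂ (inj₂ (inj₂ (inj₁ β))))        → ruled-out Q8⋊Z3-table  β 2 2 refl
    (inj₂ (inj₂ (inj₂ (inj₂ (inj₁ β))))) → ruled-out Q8⋊Z9-table  β 2 2 refl
    (inj₂ (inj₂ (inj₂ (inj₂ (inj₂ β))))) → ruled-out Z3²⋊Q8-table β 2 3 refl
  where
  ruled-out = no-kif G U V D G-CI |U|⊥|V| U-abelian
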